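{- For every graph $G$, $T(G) \le \min\{\chi'(G), \chi(K(G))\}$.
   Context: A clique is a set of vertices inducing a complete subgraph. A tessellation $\mathcal{T}$ of a graph $G$ is a partition of $V(G)$ into cliques; an edge belongs to $\mathcal{T}$ iff both endpoints lie in the same clique of $\mathcal{T}$, and $\mathcal{E}(\mathcal{T})$ denotes the set of edges belonging to $\mathcal{T}$. A tessellation cover of size $t$ of $G$ is a set of $t$ tessellations $\mathcal{T}_1,\dots,\mathcal{T}_t$ with $\bigcup_i \mathcal{E}(\mathcal{T}_i)=E(G)$. The tessellation cover number $T(G)$ is the minimum size of a tessellation cover of $G$. $\chi'(G)$ is the chromatic index of $G$, and $K(G)$ is the clique graph of $G$ (the intersection graph of the maximal cliques of $G$), with $\chi(K(G))$ its chromatic number. -}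

module Defs where

open import Data.Nat using (ℕ; _≤_; _⊓_)
open import Data.Fin using (Fin)
open import Data.Fin.Subset using (Subset; _∈_; _⊆_)
open import Data.Bool using (Bool; true)
open import Data.Product using (Σ; _×_; ∃-syntax)
open import Relation.Binary.PropositionalEquality using (_≡_; _≢_)

record Graph : Set where
  field
    n     : ℕ
    adj   : Fin n → Fin n → Bool
    sym   : ∀ u v → adj u v ≡ adj v u
    irrefl : ∀ v → adj v v ≢ true

open Graph public

Adj : (G : Graph) → Fin (n G) → Fin (n G) → Set
Adj G u v = adj G u v ≡ true

IsMin : (ℕ → Set) → ℕ → Set
IsMin P t = P t × (∀ s → P s → t ≤ s)

IsClique : (G : Graph) → Subset (n G) → Set
IsClique G S = ∀ u v → u ∈ S → v ∈ S → u ≢ v → Adj G u v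

IsMaximalClique : (G : Graph) → Subset (n G) → Set
IsMaximalClique G S =
  IsClique G S × (∀ S' → IsClique G S' → S ⊆ S' → S' ⊆ S)

-- Tessellations: a partition of V(G) into cliques, given by a labelling
-- of the vertices (the parts are the label classes); each part must be
-- a clique.  The edge uv belongs to the tessellation iff u and v have
-- the same label.

IsTessellation : (G : Graph) → (Fin (n G) → ℕ) → Set
IsTessellation G c = ∀ u v → c u ≡ c v → u ≢ v → Adj G u v

HasTessellationCover : (G : Graph) → ℕ → Set
HasTessellationCover G t =
  Σ (Fin t → Fin (n G) → ℕ) λ T →
    (∀ i → IsTessellation G (T i)) ×
    (∀ u v → Adj G u v → ∃[ i ] (T i u ≡ T i v))

IsTessellationCoverNumber : Graph → ℕ → Set
IsTessellationCoverNumber G = IsMin (HasTessellationCover G)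

-- The colour of
-- edge uv is f u v (values on non-edges are irrelevant); f must be
-- symmetric on edges, and distinct edges sharing an endpoint receive
-- distinct colours.

IsProperEdgeColouring : (G : Graph) (k : ℕ) → (Fin (n G) → Fin (n G) → Fin k) → Set
IsProperEdgeColouring G k f =
  (∀ u v → Adj G u v → f u v ≡ f v u) ×
  (∀ u v w → Adj G u v → Adj G u w → v ≢ w → f u v ≢ f u w)

EdgeColourable : Graph → ℕ → Set
EdgeColourable G k = Σ (Fin (n G) → Fin (n G) → Fin k) (IsProperEdgeColouring G k)

IsChromaticIndex : Graph → ℕ → Set
IsChromaticIndex G = IsMin (EdgeColourable G)

-- Clique graph K(G): vertices are the maximal cliques of G, two distinct
-- maximal cliques adjacent iff they intersect.  A proper k-colouring of
-- K(G) assigns a colour to each maximal clique (values on other subsets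
-- are irrelevant) with adjacent vertices of K(G) coloured differently.

IsProperCliqueGraphColouring : (G : Graph) (k : ℕ) → (Subset (n G) → Fin k) → Set
IsProperCliqueGraphColouring G k col =
  ∀ Q Q' → IsMaximalClique G Q → IsMaximalClique G Q' → Q ≢ Q' →
    (∃[ v ] (v ∈ Q × v ∈ Q')) → col Q ≢ col Q'

CliqueGraphColourable : Graph → ℕ → Set
CliqueGraphColourable G k =
  Σ (Subset (n G) → Fin k) (IsProperCliqueGraphColouring G k)

IsCliqueGraphChromaticNumber : Graph → ℕ → Set
IsCliqueGraphChromaticNumber G = IsMin (CliqueGraphColourable G)

-- Both bounds come from one observation: a family of pairwise disjoint
-- cliques (a "clique packing") lies inside a single tessellation, namely
-- the packing completed by singleton parts.  So if the edges of G are
-- covered by k clique packings, then T(G) ≤ k.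
--
-- * A proper edge colouring with e colours yields e packings: the i-th
--   colour class is a matching, i.e. a family of disjoint 2-cliques.
-- * A proper colouring of K(G) with k colours yields k packings: maximal
--   cliques of equal colour are non-adjacent in K(G), i.e. disjoint; and
--   every edge lies in some maximal clique.

module Submission where

open import Defs hiding (sym)
open import Data.Nat using (ℕ; _≤_; _⊓_; _<_; _∸_)
open import Data.Nat.Properties using (∸-monoʳ-<; ⊓-glb)
open import Data.Nat.Induction using (<-wellFounded)
open import Induction.WellFounded using (Acc; acc)
open import Data.Fin using (Fin; toℕ)
open import Data.Fin.Properties using (toℕ-injective; any?; all?) renaming (_≟_ to _≟ᶠ_)
open import Data.Fin.Subset using (Subset; _∈_; _⊆_; _⊂_; _∪_; ⁅_⁆; ∣_∣)
open import Data.Fin.Subset.Properties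
  using (_∈?_; _⊂?_; anySubset?; ⊆-trans; ∣p∣≤n; p⊂q⇒∣p∣<∣q∣; ∪-comm; x∈p∪q⁻; x∈p∪q⁺; x∈⁅x⁆; x∈⁅y⁆⇒x≡y)
open import Data.Bool using (true) renaming (_≟_ to _≟ᵇ_)
open import Data.Vec.Properties using (≡-dec)
open import Data.Product using (_×_; _,_; proj₁; proj₂; ∃; ∃-syntax)
open import Data.Sum using (_⊎_; inj₁; inj₂)
open import Function using (_∘_; id)
open import Relation.Nullary using (¬_; Dec; yes; no; contradiction)
open import Relation.Nullary.Decidable using (_×-dec_; _→-dec_; ¬?; decidable-stable)
open import Relation.Unary using (Decidable)
open import Relation.Binary.PropositionalEquality using (_≡_; _≢_; refl; sym; trans; cong; subst)

module _ (G : Graph) where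
  private
    N = n G
    V = Fin N

  adj-sym : ∀ {u v} → Adj G u v → Adj G v u
  adj-sym {u} {v} uv = trans (Graph.sym G v u) uv

  adj? : ∀ u v → Dec (Adj G u v)
  adj? u v = adj G u v ≟ᵇ true

  _≟ˢ_ : (S S' : Subset N) → Dec (S ≡ S')
  _≟ˢ_ = ≡-dec _≟ᵇ_

  clique? : Decidable (IsClique G)
  clique? S = all? λ u → all? λ v →
    (u ∈? S) →-dec ((v ∈? S) →-dec (¬? (u ≟ᶠ v) →-dec adj? u v))

  record IsCliquePacking (Sel : Subset N → Set) : Set where
    field
      cliques  : ∀ {S} → Sel S → IsClique G S
      disjoint : ∀ {S S' x} → Sel S → Sel S' → x ∈ S → x ∈ S' → S ≡ S'

  -- A decidable clique packing is contained in one tessellation: every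
  -- vertex of a member S is labelled by (the index of) the first vertex
  -- of S, every other vertex by its own index.
  module PackingTessellation {Sel : Subset N → Set}
           (Sel? : Decidable Sel) (packing : IsCliquePacking Sel) where
    open IsCliquePacking packing

    firstFrom : (S : Subset N) → Dec (∃ (_∈ S)) → ℕ
    firstFrom S (yes (w , _)) = toℕ w
    firstFrom S (no _)        = 0

    first : Subset N → ℕ
    first S = firstFrom S (any? (_∈? S))

    first-spec : ∀ {S x} → x ∈ S → ∃ λ w → w ∈ S × first S ≡ toℕ w
    first-spec {S} x∈S with any? (_∈? S)
    ... | yes (w , w∈S) = w , w∈S , refl
    ... | no ∄w         = contradiction (_ , x∈S) ∄w

    first-member : ∀ {S x v} → x ∈ S → first S ≡ toℕ v → v ∈ S
    first-member x∈S eq with first-spec x∈S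
    ... | w , w∈S , first≡w = subst (_∈ _) (toℕ-injective (trans (sym first≡w) eq)) w∈S

    Block : V → Set
    Block u = ∃ λ S → Sel S × u ∈ S

    labelFrom : ∀ {u} → Dec (Block u) → ℕ
    labelFrom (yes (S , _)) = first S
    labelFrom {u} (no _)    = toℕ u

    label : V → ℕ
    label u = labelFrom (anySubset? (λ S → Sel? S ×-dec (u ∈? S)))

    data LabelView (u : V) : ℕ → Set where
      inBlock : ∀ {S} → Sel S → u ∈ S → LabelView u (first S)
      free    : ¬ Block u → LabelView u (toℕ u)

    labelView : ∀ u → LabelView u (label u)
    labelView u = from (anySubset? (λ S → Sel? S ×-dec (u ∈? S)))
      where
      from : (d : Dec (Block u)) → LabelView u (labelFrom d)
      from (yes (S , sel , u∈S)) = inBlock sel u∈S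
      from (no ¬block)           = free ¬block

    -- Equal labels of distinct vertices force them into a common member.
    labels-meet : ∀ {u v l l'} → LabelView u l → LabelView v l' → l ≡ l' → u ≢ v → Adj G u v
    labels-meet (free _) (free _) eq u≢v = contradiction (toℕ-injective eq) u≢v
    labels-meet (inBlock sel u∈S) (free ¬block) eq _ =
      contradiction (_ , sel , first-member u∈S eq) ¬block
    labels-meet (free ¬block) (inBlock sel v∈S) eq _ =
      contradiction (_ , sel , first-member v∈S (sym eq)) ¬block
    labels-meet (inBlock {S} sel u∈S) (inBlock {S'} sel' v∈S') eq u≢v =
      cliques sel _ _ u∈S (subst (_ ∈_) (sym S≡S') v∈S') u≢v
      where
      S≡S' : S ≡ S'
      S≡S' with first-spec u∈S
      ... | w , w∈S , first≡w = disjoint sel sel' w∈S (first-member v∈S' (trans (sym eq) first≡w))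

    label-in-block : ∀ {u l S} → LabelView u l → Sel S → u ∈ S → l ≡ first S
    label-in-block (inBlock sel u∈S) sel' u∈S' = cong first (disjoint sel sel' u∈S u∈S')
    label-in-block (free ¬block) sel u∈S = contradiction (_ , sel , u∈S) ¬block

    tessellation : IsTessellation G label
    tessellation u v = labels-meet (labelView u) (labelView v)

    same-label : ∀ {S u v} → Sel S → u ∈ S → v ∈ S → label u ≡ label v
    same-label sel u∈S v∈S =
      trans (label-in-block (labelView _) sel u∈S) (sym (label-in-block (labelView _) sel v∈S))

  coverFromPackings : ∀ {k} (Sel : Fin k → Subset N → Set) →
    (∀ i → Decidable (Sel i)) → (∀ i → IsCliquePacking (Sel i)) →
    (∀ u v → Adj G u v → ∃[ i ] ∃[ S ] (Sel i S × u ∈ S × v ∈ S)) →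
    HasTessellationCover G k
  coverFromPackings Sel Sel? packing edge-covered =
    (λ i → label i) , (λ i → tessellation i) , covers
    where
    open module P i = PackingTessellation (Sel? i) (packing i)
    covers : ∀ u v → Adj G u v → ∃[ i ] (label i u ≡ label i v)
    covers u v uv with edge-covered u v uv
    ... | i , S , sel , u∈S , v∈S = i , same-label i sel u∈S v∈S

  edge : V → V → Subset N
  edge u v = ⁅ u ⁆ ∪ ⁅ v ⁆

  ∈-edge : ∀ {x u v} → x ∈ edge u v → x ≡ u ⊎ x ≡ v
  ∈-edge {u = u} {v} x∈uv with x∈p∪q⁻ ⁅ u ⁆ ⁅ v ⁆ x∈uv
  ... | inj₁ x∈u = inj₁ (x∈⁅y⁆⇒x≡y u x∈u)
  ... | inj₂ x∈v = inj₂ (x∈⁅y⁆⇒x≡y v x∈v)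

  left∈edge : ∀ u v → u ∈ edge u v
  left∈edge u v = x∈p∪q⁺ (inj₁ (x∈⁅x⁆ u))

  right∈edge : ∀ u v → v ∈ edge u v
  right∈edge u v = x∈p∪q⁺ (inj₂ (x∈⁅x⁆ v))

  edge-clique : ∀ {u v} → Adj G u v → IsClique G (edge u v)
  edge-clique uv x y x∈ y∈ x≢y with ∈-edge x∈ | ∈-edge y∈
  ... | inj₁ refl | inj₁ refl = contradiction refl x≢y
  ... | inj₁ refl | inj₂ refl = uv
  ... | inj₂ refl | inj₁ refl = adj-sym uv
  ... | inj₂ refl | inj₂ refl = contradiction refl x≢y

  module EdgeColouring {e} (f : V → V → Fin e) (proper : IsProperEdgeColouring G e f) where
    private
      colour-sym = proj₁ proper
      colour-proper = proj₂ proper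

    ColourClass : Fin e → Subset N → Set
    ColourClass i S = ∃[ u ] ∃[ v ] (Adj G u v × f u v ≡ i × S ≡ edge u v)

    colourClass? : ∀ i → Decidable (ColourClass i)
    colourClass? i S = any? λ u → any? λ v → adj? u v ×-dec (f u v ≟ᶠ i) ×-dec (S ≟ˢ edge u v)

    reanchor : ∀ {i u v x} → Adj G u v → f u v ≡ i → x ∈ edge u v →
      ∃[ y ] (Adj G x y × f x y ≡ i × edge u v ≡ edge x y)
    reanchor {u = u} {v} uv fuv x∈ with ∈-edge x∈
    ... | inj₁ refl = v , uv , fuv , refl
    ... | inj₂ refl = u , adj-sym uv , trans (sym (colour-sym u v uv)) fuv , ∪-comm ⁅ u ⁆ ⁅ v ⁆

    colour-unique : ∀ {i x y y'} → Adj G x y → Adj G x y' → f x y ≡ i → f x y' ≡ i → y ≡ y'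
    colour-unique {x = x} {y} {y'} xy xy' fy fy' with y ≟ᶠ y'
    ... | yes y≡y' = y≡y'
    ... | no y≢y'  = contradiction (trans fy (sym fy')) (colour-proper x y y' xy xy' y≢y')

    colourClass-packing : ∀ i → IsCliquePacking (ColourClass i)
    colourClass-packing i = record { cliques = cliques ; disjoint = disjoint }
      where
      cliques : ∀ {S} → ColourClass i S → IsClique G S
      cliques (_ , _ , uv , _ , refl) = edge-clique uv

      disjoint : ∀ {S S' x} → ColourClass i S → ColourClass i S' → x ∈ S → x ∈ S' → S ≡ S'
      disjoint (_ , _ , uv , fuv , refl) (_ , _ , uv' , fuv' , refl) x∈ x∈'
        with reanchor uv fuv x∈ | reanchor uv' fuv' x∈'
      ... | y , xy , fy , S≡xy | y' , xy' , fy' , S'≡xy'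
        rewrite colour-unique xy xy' fy fy' = trans S≡xy (sym S'≡xy')

    cover : HasTessellationCover G e
    cover = coverFromPackings ColourClass colourClass? colourClass-packing
      λ u v uv → f u v , edge u v , (u , v , uv , refl , refl) , left∈edge u v , right∈edge u v

  Extendable : Subset N → Set
  Extendable S = ∃ λ S' → IsClique G S' × S ⊂ S'

  extendable? : Decidable Extendable
  extendable? S = anySubset? λ S' → clique? S' ×-dec (S ⊂? S')

  unextendable⇒maximal : ∀ {Q} → IsClique G Q → ¬ Extendable Q → IsMaximalClique G Q
  unextendable⇒maximal {Q} clique ¬ext = clique , λ S' clique' Q⊆S' {x} x∈S' →
    decidable-stable (x ∈? Q) λ x∉Q → ¬ext (S' , clique' , Q⊆S' , x , x∈S' , x∉Q)

  maximal⇒unextendable : ∀ {Q} → IsMaximalClique G Q → ¬ Extendable Q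
  maximal⇒unextendable (_ , maximal) (S' , clique' , Q⊆S' , x , x∈S' , x∉Q) =
    x∉Q (maximal S' clique' Q⊆S' x∈S')

  maximal? : Decidable (IsMaximalClique G)
  maximal? Q with clique? Q | extendable? Q
  ... | no ¬clique | _       = no (¬clique ∘ proj₁)
  ... | yes _      | yes ext = no λ max → maximal⇒unextendable max ext
  ... | yes clique | no ¬ext = yes (unextendable⇒maximal clique ¬ext)

  -- Proper extension decreases the number of vertices left outside,
  -- which makes greedy extension terminate.
  ⊂-shrinks-outside : ∀ {S S'} → S ⊂ S' → N ∸ ∣ S' ∣ < N ∸ ∣ S ∣
  ⊂-shrinks-outside {S' = S'} S⊂S' = ∸-monoʳ-< (p⊂q⇒∣p∣<∣q∣ S⊂S') (∣p∣≤n S')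

  extend-to-maximal : ∀ {S} → IsClique G S → ∃ λ Q → IsMaximalClique G Q × S ⊆ Q
  extend-to-maximal {S} = go S (<-wellFounded (N ∸ ∣ S ∣))
    where
    go : ∀ S → Acc _<_ (N ∸ ∣ S ∣) → IsClique G S → ∃ λ Q → IsMaximalClique G Q × S ⊆ Q
    go S (acc smaller) clique with extendable? S
    ... | no ¬ext = S , unextendable⇒maximal clique ¬ext , id
    ... | yes (S' , clique' , S⊂S') with go S' (smaller (⊂-shrinks-outside S⊂S')) clique'
    ...   | Q , max , S'⊆Q = Q , max , ⊆-trans (proj₁ S⊂S') S'⊆Q

  module CliqueGraphColouring {k} (col : Subset N → Fin k)
           (proper : IsProperCliqueGraphColouring G k col) where

    ColourClass : Fin k → Subset N → Set
    ColourClass j Q = IsMaximalClique G Q × col Q ≡ j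

    colourClass? : ∀ j → Decidable (ColourClass j)
    colourClass? j Q = maximal? Q ×-dec (col Q ≟ᶠ j)

    -- Intersecting maximal cliques of equal colour coincide, since
    -- distinct ones would be adjacent in K(G).
    colourClass-packing : ∀ j → IsCliquePacking (ColourClass j)
    colourClass-packing j = record { cliques = proj₁ ∘ proj₁ ; disjoint = disjoint }
      where
      disjoint : ∀ {Q Q' x} → ColourClass j Q → ColourClass j Q' → x ∈ Q → x ∈ Q' → Q ≡ Q'
      disjoint {Q} {Q'} (max , colQ) (max' , colQ') x∈Q x∈Q' with Q ≟ˢ Q'
      ... | yes Q≡Q' = Q≡Q'
      ... | no Q≢Q'  = contradiction (trans colQ (sym colQ'))
                         (proper Q Q' max max' Q≢Q' (_ , x∈Q , x∈Q'))

    cover : HasTessellationCover G k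
    cover = coverFromPackings ColourClass colourClass? colourClass-packing covered
      where
      covered : ∀ u v → Adj G u v → ∃[ j ] ∃[ Q ] (ColourClass j Q × u ∈ Q × v ∈ Q)
      covered u v uv with extend-to-maximal (edge-clique uv)
      ... | Q , max , uv⊆Q = col Q , Q , (max , refl) , uv⊆Q (left∈edge u v) , uv⊆Q (right∈edge u v)

theorem1 : (G : Graph) (t e k : ℕ) →
    IsTessellationCoverNumber G t → IsChromaticIndex G e →
    IsCliqueGraphChromaticNumber G k → t ≤ e ⊓ k
theorem1 G t e k (_ , t-minimal) ((f , edge-proper) , _) ((col , clique-proper) , _) =
  ⊓-glb (t-minimal e (EdgeColouring.cover G f edge-proper))
        (t-minimal k (CliqueGraphColouring.cover G col clique-proper))
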